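{- Let $n$ be a positive integer and let $u,v,w$ be integers with $0\le u,v\le n-1$, $u+v=2w-1$ and $1\le w\le n-1$. Then for every odd prime $p$, $$\nu_p\!\left(\binom{n-1}{u}\binom{n-1}{v}\right)\ge \nu_p(2w)+\frac{2-(2n-2w)}{p-1}\quad\text{and}\quad \nu_p\!\left(\binom{n-1}{u}\binom{n-1}{v}\right)\ge\nu_p(2n-2w)+\frac{2-2w}{p-1},$$ and for $p=2$, $$\nu_2\!\left(\binom{n-1}{u}\binom{n-1}{v}\right)\ge \nu_2(2w)-(n-w)\quad\text{and}\quad \nu_2\!\left(\binom{n-1}{u}\binom{n-1}{v}\right)\ge \nu_2(2n-2w)-w.$$
   Context: For a prime $p$ and nonzero rational $r$, $\nu_p(r)$ is the $p$-adic valuation: $\nu_p(r)=m$ when $r=p^m\alpha/\beta$ with $p\nmid\alpha\beta$. -}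

module Defs where

open import Data.Nat using (ℕ; suc; _^_)
open import Data.Nat.Divisibility using (_∣_)
open import Data.Product using (_×_)
open import Relation.Nullary using (¬_)

Valuation : (p m k : ℕ) → Set
Valuation p m k = (p ^ k ∣ m) × ¬ (p ^ suc k ∣ m)

open import Data.Integer using (ℤ)
open import Data.Rational using (ℚ; _/_; 0ℚ)

-- z / (p - 1) as a rational number; only meaningful for p ≥ 2
-- (used only for primes p, where p - 1 ≥ 1). Junk value 0 for p ≤ 1.
divPred : ℤ → ℕ → ℚ
divPred z 0 = 0ℚ
divPred z 1 = 0ℚ
divPred z (suc (suc k)) = z / suc k

-- Put N = n − 1 and M = n − w, so that (N − u) + (N − v) + 1 = 2M. One of u, v, say u, is
-- smaller than w, and C(N, u) · (N − u)! = (u + 1)(u + 2) ⋯ N is a product of N − u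
-- consecutive integers containing w. Such a product has p-adic valuation at least
-- ν_p(w) + ν_p(⌊(N − u)/p⌋!), whereas ν_p((N − u)!) = q + ν_p(q!) with q = ⌊(N − u)/p⌋;
-- hence ν_p(C(N, u) C(N, v)) ≥ ν_p(w) − q with p q < 2M. This gives both bounds for odd p
-- (where ν_p(2w) = ν_p(w)) and for p = 2 (where ν_2(2w) = ν_2(w) + 1). The bounds involving
-- 2n − 2w are the same argument for N − u, N − v and M, since C(N, k) = C(N, N − k).

module Submission where

open import Defs
open import Data.Nat using (ℕ; suc; _+_; _*_; _∸_; _≤_; _<_)
open import Data.Nat.Combinatorics using (_C_)
open import Data.Nat.Primality using (Prime)
open import Data.Integer using (+_) renaming (_-_ to _-ℤ_)
open import Data.Rational using (ℚ; _/_) renaming (_+_ to _+ℚ_; _-_ to _-ℚ_; _≤_ to _≤ℚ_)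
open import Data.Product using (_×_)
open import Relation.Binary.PropositionalEquality using (_≡_; _≢_)

open import Data.Nat hiding (_/_; _%_)
open import Data.Nat.Base using () renaming (_/_ to _div_; _%_ to _mod_)
open import Data.Nat.Properties
open import Data.Nat.Divisibility
open import Data.Nat.DivMod using (m/n*n≡m; m≡m%n+[m/n]*n; m%n<n; m/n<m; m/n*n≤m)
open import Data.Nat.Combinatorics using (nCk≡n!/k![n-k]!; k![n∸k]!∣n!; nCk≡nC[n∸k])
open import Data.Nat.Primality using (euclidsLemma; prime⇒nonZero; prime⇒nonTrivial; ¬prime[0]; ¬prime[1]; prime[2])
open import Data.Nat.Tactic.RingSolver using (solve-∀)
open import Data.Nat.Induction using (<-wellFounded)
open import Induction.WellFounded using (Acc; acc)
open import Data.Product using (∃; ∃₂; _,_; proj₁; proj₂)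
open import Data.Sum using (inj₁; inj₂)
open import Relation.Nullary using (¬_; yes; no; contradiction)
open import Relation.Binary.PropositionalEquality
import Data.Integer as ℤ
import Data.Integer.Properties as ℤₚ
import Data.Rational as ℚ
import Data.Rational.Properties as ℚₚ
open import Data.Rational.Unnormalised as ℚᵘ using (mkℚᵘ)
import Data.Rational.Unnormalised.Properties as ℚᵘₚ

-- rising s L = (s + 1)(s + 2) ⋯ (s + L) = (s + L)! / s!, not the usual rising factorial of s.
rising : ℕ → ℕ → ℕ
rising s zero    = 1
rising s (suc L) = rising s L * (s + suc L)

rising*!≡! : ∀ s L → rising s L * s ! ≡ (s + L) !
rising*!≡! s zero    = trans (+-identityʳ (s !)) (cong _! (sym (+-identityʳ s)))
rising*!≡! s (suc L) = begin
  rising s L * (s + suc L) * s !  ≡⟨ reorder (rising s L) (s + suc L) (s !) ⟩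
  (s + suc L) * (rising s L * s !) ≡⟨ cong ((s + suc L) *_) (rising*!≡! s L) ⟩
  (s + suc L) * (s + L) !         ≡⟨ cong (λ t → t * (s + L) !) (+-suc s L) ⟩
  suc (s + L) !                   ≡⟨ cong _! (+-suc s L) ⟨
  (s + suc L) !                   ∎
  where
  open ≡-Reasoning
  reorder : ∀ x y z → x * y * z ≡ y * (x * z)
  reorder = solve-∀

rising-+ : ∀ s L₁ L₂ → rising s (L₁ + L₂) ≡ rising s L₁ * rising (s + L₁) L₂
rising-+ s L₁ zero     = trans (cong (rising s) (+-identityʳ L₁)) (sym (*-identityʳ _))
rising-+ s L₁ (suc L₂) = begin
  rising s (L₁ + suc L₂)                         ≡⟨ cong (rising s) (+-suc L₁ L₂) ⟩
  rising s (L₁ + L₂) * (s + suc (L₁ + L₂))       ≡⟨ cong₂ _*_ (rising-+ s L₁ L₂) last ⟩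
  rising s L₁ * rising (s + L₁) L₂ * (s + L₁ + suc L₂) ≡⟨ *-assoc (rising s L₁) _ _ ⟩
  rising s L₁ * rising (s + L₁) (suc L₂)         ∎
  where
  open ≡-Reasoning
  last : s + suc (L₁ + L₂) ≡ s + L₁ + suc L₂
  last = trans (cong (_+_ s) (sym (+-suc L₁ L₂))) (sym (+-assoc s L₁ (suc L₂)))

nCk*[k!*[n∸k]!]≡n! : ∀ {n k} → k ≤ n → (n C k) * (k ! * (n ∸ k) !) ≡ n !
nCk*[k!*[n∸k]!]≡n! {n} {k} k≤n = trans (cong (_* (k ! * (n ∸ k) !)) (nCk≡n!/k![n-k]! k≤n))
                                       (m/n*n≡m {{k !* (n ∸ k) !≢0}} (k![n∸k]!∣n! k≤n))

rising≡C*! : ∀ s L → rising s L ≡ ((s + L) C s) * L !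
rising≡C*! s L = *-cancelʳ-≡ (rising s L) (((s + L) C s) * L !) (s !) {{s !≢0}} (begin
  rising s L * s !                      ≡⟨ rising*!≡! s L ⟩
  (s + L) !                             ≡⟨ nCk*[k!*[n∸k]!]≡n! (m≤m+n s L) ⟨
  ((s + L) C s) * (s ! * (s + L ∸ s) !) ≡⟨ cong (λ d → ((s + L) C s) * (s ! * d !)) (m+n∸m≡n s L) ⟩
  ((s + L) C s) * (s ! * L !)           ≡⟨ reorder ((s + L) C s) (s !) (L !) ⟩
  ((s + L) C s) * L ! * s !             ∎)
  where
  open ≡-Reasoning
  reorder : ∀ x y z → x * (y * z) ≡ x * z * y
  reorder = solve-∀

L!∣rising : ∀ s L → L ! ∣ rising s L
L!∣rising s L = subst (L ! ∣_) (sym (rising≡C*! s L)) (n∣m*n ((s + L) C s))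

rising0≡! : ∀ L → rising 0 L ≡ L !
rising0≡! L = trans (sym (*-identityʳ (rising 0 L))) (rising*!≡! 0 L)

u+v+1≡2w⇒w≤u⇒v<w : ∀ {u v w} → u + v + 1 ≡ 2 * w → w ≤ u → v < w
u+v+1≡2w⇒w≤u⇒v<w {u} {v} {w} u+v+1≡2w w≤u = +-cancelʳ-≤ w (suc v) w (begin
  suc v + w  ≤⟨ +-monoʳ-≤ (suc v) w≤u ⟩
  suc v + u  ≡⟨ rearrange u v ⟩
  u + v + 1  ≡⟨ u+v+1≡2w ⟩
  2 * w      ≡⟨ cong (_+_ w) (+-identityʳ w) ⟩
  w + w      ∎)
  where
  open ≤-Reasoning
  rearrange : ∀ u v → suc v + u ≡ u + v + 1
  rearrange = solve-∀

[N∸u]+[N∸v]+1≡2M : ∀ {N u v w M} → u + v + 1 ≡ 2 * w → u ≤ N → v ≤ N → w + M ≡ suc N →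
                    (N ∸ u) + (N ∸ v) + 1 ≡ 2 * M
[N∸u]+[N∸v]+1≡2M {N} {u} {v} {w} {M} u+v+1≡2w u≤N v≤N w+M≡1+N = +-cancelʳ-≡ (2 * w) _ _ (begin
  (N ∸ u) + (N ∸ v) + 1 + 2 * w         ≡⟨ cong (_+_ ((N ∸ u) + (N ∸ v) + 1)) u+v+1≡2w ⟨
  (N ∸ u) + (N ∸ v) + 1 + (u + v + 1)   ≡⟨ rearrange (N ∸ u) (N ∸ v) u v ⟩
  suc ((N ∸ u) + u) + suc ((N ∸ v) + v) ≡⟨ cong₂ (λ s t → suc s + suc t) (m∸n+n≡m u≤N) (m∸n+n≡m v≤N) ⟩
  suc N + suc N                         ≡⟨ cong₂ _+_ w+M≡1+N w+M≡1+N ⟨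
  (w + M) + (w + M)                     ≡⟨ double w M ⟩
  2 * M + 2 * w                         ∎)
  where
  open ≡-Reasoning
  rearrange : ∀ a b u v → a + b + 1 + (u + v + 1) ≡ suc (a + u) + suc (b + v)
  rearrange = solve-∀
  double : ∀ w M → (w + M) + (w + M) ≡ 2 * M + 2 * w
  double = solve-∀

N∸u<2M : ∀ {N u v w M} → u + v + 1 ≡ 2 * w → u ≤ N → v ≤ N → w + M ≡ suc N → N ∸ u < 2 * M
N∸u<2M {N} {u} {v} {w} u+v+1≡2w u≤N v≤N w+M≡1+N =
  subst (N ∸ u <_) ([N∸u]+[N∸v]+1≡2M {w = w} u+v+1≡2w u≤N v≤N w+M≡1+N)
    (subst (suc (N ∸ u) ≤_) (+-comm 1 _) (s≤s (m≤m+n (N ∸ u) (N ∸ v))))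

ValuationBound : (p A W M : ℕ) → Set
ValuationBound p A W M = ∀ {α β} → Valuation p A α → p ^ β ∣ W → ∃ λ q → p * q < 2 * M × β ≤ α + q

module _ {p : ℕ} (p-prime : Prime p) where

  private instance
    p≢0 : NonZero p
    p≢0 = prime⇒nonZero p-prime

  1<p : 1 < p
  1<p = nonTrivial⇒n>1 p {{prime⇒nonTrivial p-prime}}

  p∤1 : ¬ p ∣ 1
  p∤1 p∣1 = <⇒≢ 1<p (sym (∣1⇒≡1 p∣1))

  p∤* : ∀ {m n} → ¬ p ∣ m → ¬ p ∣ n → ¬ p ∣ m * n
  p∤* {m} {n} p∤m p∤n p∣mn with euclidsLemma m n p-prime p∣mn
  ... | inj₁ p∣m = p∤m p∣m
  ... | inj₂ p∣n = p∤n p∣n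

  p^j∣m*n⇒p^j∣m : ∀ {n} → ¬ p ∣ n → ∀ j {m} → p ^ j ∣ m * n → p ^ j ∣ m
  p^j∣m*n⇒p^j∣m p∤n zero    {m} _ = 1∣ m
  p^j∣m*n⇒p^j∣m {n} p∤n (suc j) {m} p^[1+j]∣mn
    with p^j∣m*n⇒p^j∣m p∤n j {m} (∣-trans (n∣m*n p) p^[1+j]∣mn)
  ... | divides m′ refl = *-monoˡ-∣ (p ^ j) p∣m′
    where
    reorder : ∀ x y z → x * y * z ≡ y * (x * z)
    reorder = solve-∀
    p∣m′n : p ∣ m′ * n
    p∣m′n = *-cancelˡ-∣ (p ^ j) {{m^n≢0 p j}}
              (subst₂ _∣_ (*-comm p (p ^ j)) (reorder m′ (p ^ j) n) p^[1+j]∣mn)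
    p∣m′ : p ∣ m′
    p∣m′ with euclidsLemma m′ n p-prime p∣m′n
    ... | inj₁ p∣m′ = p∣m′
    ... | inj₂ p∣n  = contradiction p∣n p∤n

  p^i∣p^j*m⇒p^[i∸j]∣m : ∀ i j {m} → p ^ i ∣ p ^ j * m → p ^ (i ∸ j) ∣ m
  p^i∣p^j*m⇒p^[i∸j]∣m i j {m} p^i∣p^jm with i ≤? j
  ... | yes i≤j = subst (λ t → p ^ t ∣ m) (sym (m≤n⇒m∸n≡0 i≤j)) (1∣ m)
  ... | no  i≰j = *-cancelˡ-∣ (p ^ j) {{m^n≢0 p j}} (subst (_∣ p ^ j * m) p^i≡p^j*p^[i∸j] p^i∣p^jm)
    where
    p^i≡p^j*p^[i∸j] : p ^ i ≡ p ^ j * p ^ (i ∸ j)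
    p^i≡p^j*p^[i∸j] = trans (cong (p ^_) (sym (m+[n∸m]≡n (≰⇒≥ i≰j)))) (^-distribˡ-+-* p j (i ∸ j))

  p^i∣p^j*m⇒i≤j : ∀ {m} → ¬ p ∣ m → ∀ i j → p ^ i ∣ p ^ j * m → i ≤ j
  p^i∣p^j*m⇒i≤j p∤m i j p^i∣p^jm with i ∸ j in i∸j≡ | p^i∣p^j*m⇒p^[i∸j]∣m i j p^i∣p^jm
  ... | zero  | _        = m∸n≡0⇒m≤n i∸j≡
  ... | suc t | p^[1+t]∣m = contradiction (∣-trans (m∣m*n (p ^ t)) p^[1+t]∣m) p∤m

  p-free-factorisation : ∀ n → .{{NonZero n}} → ∃₂ λ e m → ¬ p ∣ m × n ≡ p ^ e * m
  p-free-factorisation n = go n (<-wellFounded n)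
    where
    go : ∀ n → Acc _<_ n → .{{NonZero n}} → ∃₂ λ e m → ¬ p ∣ m × n ≡ p ^ e * m
    go n (acc rec) with p ∣? n
    ... | no  p∤n = 0 , n , p∤n , sym (*-identityˡ n)
    ... | yes (divides n′ refl) with go n′ (rec n′<n′*p) {{m*n≢0⇒m≢0 n′}}
      where
      n′<n′*p : n′ < n′ * p
      n′<n′*p = m<m*n n′ p {{m*n≢0⇒m≢0 n′}} 1<p
    ...   | e , m , p∤m , n′≡ = suc e , m , p∤m , (begin
      n′ * p         ≡⟨ cong (_* p) n′≡ ⟩
      p ^ e * m * p  ≡⟨ reorder (p ^ e) m p ⟩
      p * p ^ e * m  ∎)
      where
      open ≡-Reasoning
      reorder : ∀ x y z → x * y * z ≡ z * x * y
      reorder = solve-∀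

  n≡p*[n/p]+n%p : ∀ n → n ≡ p * (n div p) + n mod p
  n≡p*[n/p]+n%p n = trans (m≡m%n+[m/n]*n n p) (trans (+-comm (n mod p) _) (cong (_+ n mod p) (*-comm (n div p) p)))

  p∤rising : ∀ x {r} → r < p → ¬ p ∣ rising (p * x) r
  p∤rising x {zero}  _   = p∤1
  p∤rising x {suc r} r<p = p∤* (p∤rising x (<-trans (n<1+n r) r<p)) p∤px+1+r
    where
    p∤px+1+r : ¬ p ∣ p * x + suc r
    p∤px+1+r p∣ = <⇒≱ r<p (∣⇒≤ (∣m+n∣m⇒∣n p∣ (m∣m*n x)))

  rising-by-p : ∀ s → rising s p ≡ rising s (pred p) * (s + p)
  rising-by-p s = subst (λ m → rising s m ≡ rising s (pred p) * (s + m)) (suc-pred p) refl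

  rising[p*x][p*c] : ∀ x c → ∃ λ R → ¬ p ∣ R × rising (p * x) (p * c) ≡ p ^ c * rising x c * R
  rising[p*x][p*c] x zero    = 1 , p∤1 , cong (rising (p * x)) (*-zeroʳ p)
  rising[p*x][p*c] x (suc c) with rising[p*x][p*c] x c
  ... | R , p∤R , eq = R * U , p∤* p∤R p∤U , (begin
    rising (p * x) (p * suc c)                          ≡⟨ cong (rising (p * x)) (trans (*-suc p c) (+-comm p (p * c))) ⟩
    rising (p * x) (p * c + p)                          ≡⟨ rising-+ (p * x) (p * c) p ⟩
    rising (p * x) (p * c) * rising t p                 ≡⟨ cong₂ _*_ eq (rising-by-p t) ⟩
    p ^ c * rising x c * R * (U * (t + p))              ≡⟨ cong (λ m → p ^ c * rising x c * R * (U * m)) t+p≡ ⟩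
    p ^ c * rising x c * R * (U * (p * (x + suc c)))    ≡⟨ reorder (p ^ c) (rising x c) R U p (x + suc c) ⟩
    p ^ suc c * rising x (suc c) * (R * U)              ∎)
    where
    open ≡-Reasoning
    t = p * x + p * c
    U = rising t (pred p)
    p∤U : ¬ p ∣ U
    p∤U = subst (λ s → ¬ p ∣ rising s (pred p)) (*-distribˡ-+ p x c)
            (p∤rising (x + c) (subst (pred p <_) (suc-pred p) (n<1+n (pred p))))
    t+p≡ : t + p ≡ p * (x + suc c)
    t+p≡ = begin
      p * x + p * c + p  ≡⟨ +-assoc (p * x) (p * c) p ⟩
      p * x + (p * c + p) ≡⟨ cong (_+_ (p * x)) (trans (+-comm (p * c) p) (sym (*-suc p c))) ⟩
      p * x + p * suc c  ≡⟨ *-distribˡ-+ p x (suc c) ⟨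
      p * (x + suc c)    ∎
    reorder : ∀ P I R U p y → P * I * R * (U * (p * y)) ≡ p * P * (I * y) * (R * U)
    reorder = solve-∀

  [p*q+r]!≡p^q*q!*R : ∀ q {r} → r < p → ∃ λ R → ¬ p ∣ R × (p * q + r) ! ≡ p ^ q * q ! * R
  [p*q+r]!≡p^q*q!*R q {r} r<p with rising[p*x][p*c] 0 q
  ... | R , p∤R , eq = R * rising (p * q) r , p∤* p∤R (p∤rising q r<p) , (begin
    (p * q + r) !                              ≡⟨ rising*!≡! (p * q) r ⟨
    rising (p * q) r * (p * q) !               ≡⟨ cong (rising (p * q) r *_) [p*q]!≡ ⟩
    rising (p * q) r * (p ^ q * q ! * R)       ≡⟨ reorder (rising (p * q) r) (p ^ q) (q !) R ⟩
    p ^ q * q ! * (R * rising (p * q) r)       ∎)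
    where
    open ≡-Reasoning
    [p*q]!≡ : (p * q) ! ≡ p ^ q * q ! * R
    [p*q]!≡ = begin
      (p * q) !               ≡⟨ rising0≡! (p * q) ⟨
      rising 0 (p * q)        ≡⟨ cong (λ s → rising s (p * q)) (*-zeroʳ p) ⟨
      rising (p * 0) (p * q)  ≡⟨ eq ⟩
      p ^ q * rising 0 q * R  ≡⟨ cong (λ m → p ^ q * m * R) (rising0≡! q) ⟩
      p ^ q * q ! * R         ∎
    reorder : ∀ I P F R → I * (P * F * R) ≡ P * F * (R * I)
    reorder = solve-∀

  p^e∣n!⇒p^[e∸n/p]∣[n/p]! : ∀ {e} n → p ^ e ∣ n ! → p ^ (e ∸ n div p) ∣ (n div p) !
  p^e∣n!⇒p^[e∸n/p]∣[n/p]! {e} n p^e∣n! with [p*q+r]!≡p^q*q!*R (n div p) (m%n<n n p)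
  ... | R , p∤R , n!≡ = p^j∣m*n⇒p^j∣m p∤R (e ∸ n div p) (p^i∣p^j*m⇒p^[i∸j]∣m e (n div p)
          (subst (p ^ e ∣_) (trans (cong _! (n≡p*[n/p]+n%p n)) (trans n!≡ (*-assoc (p ^ (n div p)) _ R))) p^e∣n!))

  p*[n/p]≤n : ∀ n → p * (n div p) ≤ n
  p*[n/p]≤n n = subst (_≤ n) (*-comm (n div p) p) (m/n*n≤m n p)

  window/p : ∀ {s L w x r c r₂} → s ≡ p * x + r → r + L ≡ p * c + r₂ → r₂ < p →
             s < p * w → p * w ≤ s + L → x < w × w ≤ x + c
  window/p {s} {L} {w} {x} {r} {c} {r₂} s≡ r+L≡ r₂<p s<pw pw≤s+L = x<w , w≤x+c
    where
    open ≤-Reasoning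
    x<w : x < w
    x<w = *-cancelˡ-< p x w (begin-strict
      p * x      ≤⟨ m≤m+n (p * x) r ⟩
      p * x + r  ≡⟨ s≡ ⟨
      s          <⟨ s<pw ⟩
      p * w      ∎)
    w≤x+c : w ≤ x + c
    w≤x+c = ≤-pred (*-cancelˡ-< p w (suc (x + c)) (begin-strict
      p * w                ≤⟨ pw≤s+L ⟩
      s + L                ≡⟨ cong (_+ L) s≡ ⟩
      p * x + r + L        ≡⟨ +-assoc (p * x) r L ⟩
      p * x + (r + L)      ≡⟨ cong (_+_ (p * x)) r+L≡ ⟩
      p * x + (p * c + r₂) <⟨ +-monoʳ-< (p * x) (+-monoʳ-< (p * c) r₂<p) ⟩
      p * x + (p * c + p)  ≡⟨ arrange (p * x) (p * c) p ⟩
      p * x + p * c + p    ≡⟨ cong (_+ p) (*-distribˡ-+ p x c) ⟨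
      p * (x + c) + p      ≡⟨ +-comm (p * (x + c)) p ⟩
      p + p * (x + c)      ≡⟨ *-suc p (x + c) ⟨
      p * suc (x + c)      ∎))
      where
      arrange : ∀ a b c → a + (b + c) ≡ a + b + c
      arrange = solve-∀

  p^m∣p^n : ∀ {m n} → m ≤ n → p ^ m ∣ p ^ n
  p^m∣p^n {m} {n} m≤n =
    subst (p ^ m ∣_) (trans (sym (^-distribˡ-+-* p m (n ∸ m))) (cong (p ^_) (m+[n∸m]≡n m≤n))) (m∣m*n (p ^ (n ∸ m)))

  p^c*rising∣ : ∀ {s L x r c r₂} → s ≡ p * x + r → r + L ≡ p * c + r₂ →
                p ^ c * rising x c ∣ rising (p * x) r * rising s L
  p^c*rising∣ {s} {L} {x} {r} {c} {r₂} s≡ r+L≡ with rising[p*x][p*c] x c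
  ... | R , _ , eq = ∣-trans (m∣m*n R)
                       (∣-trans (∣-reflexive (sym eq)) (subst (rising (p * x) (p * c) ∣_) splits (m∣m*n _)))
    where
    open ≡-Reasoning
    splits : rising (p * x) (p * c) * rising (p * x + p * c) r₂ ≡ rising (p * x) r * rising s L
    splits = begin
      rising (p * x) (p * c) * rising (p * x + p * c) r₂ ≡⟨ rising-+ (p * x) (p * c) r₂ ⟨
      rising (p * x) (p * c + r₂)                         ≡⟨ cong (rising (p * x)) r+L≡ ⟨
      rising (p * x) (r + L)                              ≡⟨ rising-+ (p * x) r L ⟩
      rising (p * x) r * rising (p * x + r) L             ≡⟨ cong (λ t → rising (p * x) r * rising t L) s≡ ⟨
      rising (p * x) r * rising s L                       ∎

  -- The multiples of p among s + 1, …, s + L are p (x + 1), …, p (x + c); their product is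
  -- p^c · rising x c, and w / p lies in the window x + 1, …, x + c, so induct on β. Passing from
  -- q! to ⌊c/p⌋! loses at most ⌊c/p⌋ < c factors p, which p^c pays for.
  p^[β+e]∣rising : ∀ β {s L w q e} → s < w → w ≤ s + L → p ^ β ∣ w → p * q ≤ L → p ^ e ∣ q ! →
                   p ^ (β + e) ∣ rising s L
  p^[β+e]∣rising zero {s} {L} {q = q} _ _ _ pq≤L p^e∣q! =
    ∣-trans p^e∣q! (∣-trans (m≤n⇒m!∣n! (≤-trans (m≤n*m q p) pq≤L)) (L!∣rising s L))
  p^[β+e]∣rising (suc β) {s} {L} {w} {q} {e} s<w w≤s+L p^[1+β]∣w pq≤L p^e∣q! =
    p^j∣m*n⇒p^j∣m (p∤rising x (m%n<n s p)) (suc β + e)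
      (subst (p ^ (suc β + e) ∣_) (*-comm (rising (p * x) r) (rising s L))
        (∣-trans (p^m∣p^n exponents)
          (∣-trans p^c*IH (p^c*rising∣ (n≡p*[n/p]+n%p s) (n≡p*[n/p]+n%p (r + L))))))
    where
    x = s div p
    r = s mod p
    c = (r + L) div p
    q′ = c div p
    p∣w : p ∣ w
    p∣w = ∣-trans (m∣m*n (p ^ β)) p^[1+β]∣w
    w′ = quotient p∣w
    w≡pw′ : w ≡ p * w′
    w≡pw′ = m∣n⇒n≡m*quotient p∣w
    p^β∣w′ : p ^ β ∣ w′
    p^β∣w′ = *-cancelˡ-∣ p (subst (p ^ suc β ∣_) w≡pw′ p^[1+β]∣w)
    window : x < w′ × w′ ≤ x + c
    window = window/p (n≡p*[n/p]+n%p s) (n≡p*[n/p]+n%p (r + L)) (m%n<n (r + L) p)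
               (subst (s <_) w≡pw′ s<w) (subst (_≤ s + L) w≡pw′ w≤s+L)
    open ≤-Reasoning
    q≤c : q ≤ c
    q≤c = ≤-pred (*-cancelˡ-< p q (suc c) (begin-strict
      p * q               ≤⟨ pq≤L ⟩
      L                   ≤⟨ m≤n+m L r ⟩
      r + L               ≡⟨ n≡p*[n/p]+n%p (r + L) ⟩
      p * c + (r + L) mod p <⟨ +-monoʳ-< (p * c) (m%n<n (r + L) p) ⟩
      p * c + p           ≡⟨ +-comm (p * c) p ⟩
      p + p * c           ≡⟨ *-suc p c ⟨
      p * suc c           ∎))
    0<c : 0 < c
    0<c = +-cancelˡ-< x 0 c (subst (_< x + c) (sym (+-identityʳ x)) (<-≤-trans (proj₁ window) (proj₂ window)))
    q′<c : q′ < c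
    q′<c = m/n<m c p {{>-nonZero 0<c}} 1<p
    IH : p ^ (β + (e ∸ q′)) ∣ rising x c
    IH = p^[β+e]∣rising β (proj₁ window) (proj₂ window) p^β∣w′ (p*[n/p]≤n c)
           (p^e∣n!⇒p^[e∸n/p]∣[n/p]! c (∣-trans p^e∣q! (m≤n⇒m!∣n! q≤c)))
    p^c*IH : p ^ (c + (β + (e ∸ q′))) ∣ p ^ c * rising x c
    p^c*IH = subst (_∣ p ^ c * rising x c) (sym (^-distribˡ-+-* p c _)) (*-monoʳ-∣ (p ^ c) IH)
    exponents : suc β + e ≤ c + (β + (e ∸ q′))
    exponents = begin
      suc β + e               ≤⟨ +-monoʳ-≤ (suc β) (m≤n+m∸n e q′) ⟩
      suc β + (q′ + (e ∸ q′)) ≡⟨ swap β q′ (e ∸ q′) ⟩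
      suc q′ + (β + (e ∸ q′)) ≤⟨ +-monoˡ-≤ (β + (e ∸ q′)) q′<c ⟩
      c + (β + (e ∸ q′))      ∎
      where
      swap : ∀ b q d → suc b + (q + d) ≡ suc q + (b + d)
      swap = solve-∀

  window-valuation-bound : ∀ {u a w Y α β} → u < w → w ≤ u + a → p ^ β ∣ w →
                           Valuation p (((u + a) C u) * Y) α → β ≤ α + a div p
  window-valuation-bound {u} {a} {w} {Y} {α} {β} u<w w≤u+a p^β∣w (divides Z CY≡ , p^[1+α]∤CY)
    with [p*q+r]!≡p^q*q!*R (a div p) (m%n<n a p) | p-free-factorisation ((a div p) !) {{(a div p) !≢0}}
  ... | R , p∤R , a!≡ | e , F , p∤F , q!≡ =
    +-cancelʳ-≤ e β (α + q) (p^i∣p^j*m⇒i≤j (p∤* (p∤* p∤Z p∤F) p∤R) (β + e) (α + q + e)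
      (subst (p ^ (β + e) ∣_) rising*Y≡ (∣m⇒∣m*n Y p^[β+e]∣rising-ua)))
    where
    q = a div p
    p∤Z : ¬ p ∣ Z
    p∤Z p∣Z = p^[1+α]∤CY (subst (p ^ suc α ∣_) (sym CY≡) (*-monoˡ-∣ (p ^ α) p∣Z))
    p^[β+e]∣rising-ua : p ^ (β + e) ∣ rising u a
    p^[β+e]∣rising-ua = p^[β+e]∣rising β u<w w≤u+a p^β∣w (p*[n/p]≤n a)
                          (subst (p ^ e ∣_) (sym q!≡) (m∣m*n F))
    rising*Y≡ : rising u a * Y ≡ p ^ (α + q + e) * (Z * F * R)
    rising*Y≡ = begin
      rising u a * Y                          ≡⟨ cong (_* Y) (rising≡C*! u a) ⟩
      ((u + a) C u) * a ! * Y                 ≡⟨ swap ((u + a) C u) (a !) Y ⟩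
      ((u + a) C u) * Y * a !                 ≡⟨ cong₂ _*_ CY≡ (trans (cong _! (n≡p*[n/p]+n%p a)) a!≡) ⟩
      Z * p ^ α * (p ^ q * q ! * R)           ≡⟨ cong (λ t → Z * p ^ α * (p ^ q * t * R)) q!≡ ⟩
      Z * p ^ α * (p ^ q * (p ^ e * F) * R)   ≡⟨ gather Z (p ^ α) (p ^ q) (p ^ e) F R ⟩
      p ^ α * p ^ q * p ^ e * (Z * F * R)     ≡⟨ cong (_* (Z * F * R)) powers ⟩
      p ^ (α + q + e) * (Z * F * R)           ∎
      where
      open ≡-Reasoning
      swap : ∀ x y z → x * y * z ≡ x * z * y
      swap = solve-∀
      gather : ∀ Z A B E F R → Z * A * (B * (E * F) * R) ≡ A * B * E * (Z * F * R)
      gather = solve-∀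
      powers : p ^ α * p ^ q * p ^ e ≡ p ^ (α + q + e)
      powers = trans (cong (_* p ^ e) (sym (^-distribˡ-+-* p α q))) (sym (^-distribˡ-+-* p (α + q) e))

  binomial-valuation-bound : ∀ {N k w Y α β} → k < w → k ≤ N → w ≤ N → p ^ β ∣ w →
                             Valuation p ((N C k) * Y) α → β ≤ α + (N ∸ k) div p
  binomial-valuation-bound {N} {k} {w} {Y} {α} k<w k≤N w≤N p^β∣w ν =
    window-valuation-bound k<w (subst (w ≤_) (sym k+[N∸k]≡N) w≤N) p^β∣w
      (subst (λ n → Valuation p ((n C k) * Y) α) (sym k+[N∸k]≡N) ν)
    where
    k+[N∸k]≡N : k + (N ∸ k) ≡ N
    k+[N∸k]≡N = m+[n∸m]≡n k≤N

  binomial-product-bound : ∀ {N u v w M} → u + v + 1 ≡ 2 * w → u ≤ N → v ≤ N → w ≤ N → w + M ≡ suc N →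
                           ValuationBound p ((N C u) * (N C v)) w M
  binomial-product-bound {N} {u} {v} {w} {M} u+v+1≡2w u≤N v≤N w≤N w+M≡1+N {α} ν p^β∣w with u <? w
  ... | yes u<w = (N ∸ u) div p , ≤-<-trans (p*[n/p]≤n (N ∸ u)) (N∸u<2M {w = w} u+v+1≡2w u≤N v≤N w+M≡1+N)
                  , binomial-valuation-bound u<w u≤N w≤N p^β∣w ν
  ... | no  u≮w = (N ∸ v) div p , ≤-<-trans (p*[n/p]≤n (N ∸ v)) (N∸u<2M {w = w} v+u+1≡2w v≤N u≤N w+M≡1+N)
                  , binomial-valuation-bound (u+v+1≡2w⇒w≤u⇒v<w u+v+1≡2w (≮⇒≥ u≮w)) v≤N w≤N p^β∣w
                      (subst (λ n → Valuation p n α) (*-comm (N C u) (N C v)) ν)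
    where
    v+u+1≡2w : v + u + 1 ≡ 2 * w
    v+u+1≡2w = trans (cong (_+ 1) (+-comm v u)) u+v+1≡2w

m≤n+k⇒+m-+k≤+n : ∀ {m n k} → m ≤ n + k → + m -ℤ + k ℤ.≤ + n
m≤n+k⇒+m-+k≤+n {m} {n} {k} m≤n+k =
  subst₂ ℤ._≤_ (sym (ℤₚ.[+m]-[+n]≡m⊖n m k)) [n+k]⊖k≡n (ℤₚ.⊖-monoˡ-≤ k m≤n+k)
  where
  [n+k]⊖k≡n : (n + k) ℤ.⊖ k ≡ + n
  [n+k]⊖k≡n = trans (sym (ℤₚ.distribʳ-⊖-+-pos n k k))
                (trans (cong (ℤ._+_ (+ n)) (ℤₚ.n⊖n≡0 k)) (ℤₚ.+-identityʳ (+ n)))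

fromℚᵘ-mono-≤ : ∀ {x y} → x ℚᵘ.≤ y → ℚ.fromℚᵘ x ≤ℚ ℚ.fromℚᵘ y
fromℚᵘ-mono-≤ {x} {y} x≤y = ℚₚ.toℚᵘ-cancel-≤
  (ℚᵘₚ.≤-respʳ-≃ (ℚᵘₚ.≃-sym (ℚₚ.toℚᵘ-fromℚᵘ y))
    (ℚᵘₚ.≤-respˡ-≃ (ℚᵘₚ.≃-sym (ℚₚ.toℚᵘ-fromℚᵘ x)) x≤y))

fromℚᵘ-homo-+ : ∀ x y → ℚ.fromℚᵘ (x ℚᵘ.+ y) ≡ ℚ.fromℚᵘ x +ℚ ℚ.fromℚᵘ y
fromℚᵘ-homo-+ x y = trans (ℚₚ.fromℚᵘ-cong (ℚᵘₚ.≃-trans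
    (ℚᵘₚ.+-cong (ℚᵘₚ.≃-sym (ℚₚ.toℚᵘ-fromℚᵘ x)) (ℚᵘₚ.≃-sym (ℚₚ.toℚᵘ-fromℚᵘ y)))
    (ℚᵘₚ.≃-sym (ℚₚ.toℚᵘ-homo-+ (ℚ.fromℚᵘ x) (ℚ.fromℚᵘ y)))))
  (ℚₚ.fromℚᵘ-toℚᵘ _)

fromℚᵘ-homo‿- : ∀ x → ℚ.fromℚᵘ (ℚᵘ.- x) ≡ ℚ.- ℚ.fromℚᵘ x
fromℚᵘ-homo‿- x = trans (ℚₚ.fromℚᵘ-cong (ℚᵘₚ.≃-trans
    (ℚᵘₚ.-‿cong (ℚᵘₚ.≃-sym (ℚₚ.toℚᵘ-fromℚᵘ x)))
    (ℚᵘₚ.≃-sym (ℚₚ.toℚᵘ-homo‿- (ℚ.fromℚᵘ x)))))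
  (ℚₚ.fromℚᵘ-toℚᵘ _)

-- In ℚᵘ both the sum and the order are plain cross-multiplication, so this is the integer inequality.
n/1+z/[1+d]≤m/1 : ∀ n m z d → + (n * suc d) ℤ.+ z ℤ.≤ + (m * suc d) →
                  (+ n / 1) +ℚ (z / suc d) ≤ℚ (+ m / 1)
n/1+z/[1+d]≤m/1 n m z d ineq = subst (_≤ℚ (+ m / 1)) (fromℚᵘ-homo-+ (mkℚᵘ (+ n) 0) (mkℚᵘ z d))
  (fromℚᵘ-mono-≤ {mkℚᵘ (+ n) 0 ℚᵘ.+ mkℚᵘ z d} {mkℚᵘ (+ m) 0}
    (ℚᵘ.*≤* (subst₂ ℤ._≤_ lhs rhs ineq)))
  where
  lhs : + (n * suc d) ℤ.+ z ≡ (+ n ℤ.* + suc d ℤ.+ z ℤ.* + 1) ℤ.* + 1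
  lhs = trans (cong₂ ℤ._+_ (ℤₚ.pos-* n (suc d)) (sym (ℤₚ.*-identityʳ z))) (sym (ℤₚ.*-identityʳ _))
  rhs : + (m * suc d) ≡ + m ℤ.* (+ 1 ℤ.* + suc d)
  rhs = trans (ℤₚ.pos-* m (suc d)) (cong (ℤ._*_ (+ m)) (sym (ℤₚ.*-identityˡ (+ suc d))))

n/1+[2-T]/[1+d]≤m/1 : ∀ n m T d → n * suc d + 2 ≤ m * suc d + T →
                      (+ n / 1) +ℚ ((+ 2 -ℤ + T) / suc d) ≤ℚ (+ m / 1)
n/1+[2-T]/[1+d]≤m/1 n m T d ineq = n/1+z/[1+d]≤m/1 n m (+ 2 -ℤ + T) d
  (subst (ℤ._≤ + (m * suc d)) (ℤₚ.+-assoc (+ (n * suc d)) (+ 2) (ℤ.- + T)) (m≤n+k⇒+m-+k≤+n ineq))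

n/1-k/1≤m/1 : ∀ n m k → n ≤ m + k → (+ n / 1) -ℚ (+ k / 1) ≤ℚ (+ m / 1)
n/1-k/1≤m/1 n m k n≤m+k = subst (λ t → (+ n / 1) +ℚ t ≤ℚ (+ m / 1)) (fromℚᵘ-homo‿- (mkℚᵘ (+ k) 0))
  (n/1+z/[1+d]≤m/1 n m (ℤ.- + k) 0
    (subst₂ (λ a b → + a -ℤ + k ℤ.≤ + b) (sym (*-identityʳ n)) (sym (*-identityʳ m))
      (m≤n+k⇒+m-+k≤+n n≤m+k)))

b≤a+q⇒b*d+2≤a*d+2M : ∀ d {a b q M} → suc d * q < 2 * M → 1 ≤ M → b ≤ a + q →
                      b * d + 2 ≤ a * d + 2 * M
b≤a+q⇒b*d+2≤a*d+2M d {a} {b} {q} {M} [1+d]q<2M 1≤M b≤a+q = begin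
  b * d + 2            ≤⟨ +-monoˡ-≤ 2 (*-monoˡ-≤ d b≤a+q) ⟩
  (a + q) * d + 2      ≡⟨ rearrange a q d ⟩
  a * d + (q * d + 2)  ≤⟨ +-monoʳ-≤ (a * d) (qd+2≤2M q [1+d]q<2M) ⟩
  a * d + 2 * M        ∎
  where
  open ≤-Reasoning
  rearrange : ∀ a q d → (a + q) * d + 2 ≡ a * d + (q * d + 2)
  rearrange = solve-∀
  qd+2≤2M : ∀ q → suc d * q < 2 * M → q * d + 2 ≤ 2 * M
  qd+2≤2M zero    _         = *-monoʳ-≤ 2 1≤M
  qd+2≤2M (suc t) [1+d]q<2M = ≤-trans (≤-trans (m≤m+n _ t) (≤-reflexive (rearrange′ d t))) [1+d]q<2M
    where
    rearrange′ : ∀ d t → suc t * d + 2 + t ≡ suc (suc d * suc t)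
    rearrange′ = solve-∀

b≤a+q⇒1+b≤a+M : ∀ {a b q M} → 2 * q < 2 * M → b ≤ a + q → suc b ≤ a + M
b≤a+q⇒1+b≤a+M {a} {b} {q} {M} 2q<2M b≤a+q = begin
  suc b        ≤⟨ s≤s b≤a+q ⟩
  suc (a + q)  ≡⟨ +-suc a q ⟨
  a + suc q    ≤⟨ +-monoʳ-≤ a (*-cancelˡ-< 2 q M 2q<2M) ⟩
  a + M        ∎
  where open ≤-Reasoning

odd-prime-estimate : ∀ {p A W M a b} → Prime p → p ≢ 2 → 1 ≤ M → ValuationBound p A W M →
                     Valuation p A a → Valuation p (2 * W) b →
                     (+ b / 1) +ℚ divPred (+ 2 -ℤ + (2 * M)) p ≤ℚ (+ a / 1)
odd-prime-estimate {0} p-prime = contradiction p-prime ¬prime[0]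
odd-prime-estimate {1} p-prime = contradiction p-prime ¬prime[1]
odd-prime-estimate {2} _ p≢2 = contradiction refl p≢2
odd-prime-estimate {p@(suc (suc (suc d)))} {W = W} {M} {a} {b} p-prime _ 1≤M bound νa (p^b∣2W , _) =
  let q , pq<2M , b≤a+q = bound {a} {b} νa p^b∣W
  in n/1+[2-T]/[1+d]≤m/1 b a (2 * M) (suc d) (b≤a+q⇒b*d+2≤a*d+2M (suc (suc d)) {a} {b} {q} {M} pq<2M 1≤M b≤a+q)
  where
  p∤2 : ¬ p ∣ 2
  p∤2 p∣2 with ∣⇒≤ p∣2
  ... | s≤s (s≤s ())
  p^b∣W : p ^ b ∣ W
  p^b∣W = p^j∣m*n⇒p^j∣m p-prime p∤2 b (subst (p ^ b ∣_) (*-comm 2 W) p^b∣2W)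

two-estimate : ∀ {A W M a b} → ValuationBound 2 A W M → Valuation 2 A a → Valuation 2 (2 * W) b →
               (+ b / 1) -ℚ (+ M / 1) ≤ℚ (+ a / 1)
two-estimate {M = M} {a} {zero} _ _ _ = n/1-k/1≤m/1 0 a M z≤n
two-estimate {M = M} {a} {suc b} bound νa (2^[1+b]∣2W , _) =
  let q , 2q<2M , b≤a+q = bound {a} {b} νa (*-cancelˡ-∣ 2 2^[1+b]∣2W)
  in n/1-k/1≤m/1 (suc b) a M (b≤a+q⇒1+b≤a+M {a} {b} {q} {M} 2q<2M b≤a+q)

lemma3p4 : (n u v w : ℕ) → 1 ≤ n → u ≤ n ∸ 1 → v ≤ n ∸ 1 → u + v + 1 ≡ 2 * w → 1 ≤ w → w ≤ n ∸ 1 →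
    (∀ (p : ℕ) → Prime p → p ≢ 2 → ∀ (a b c : ℕ) →
      Valuation p (((n ∸ 1) C u) * ((n ∸ 1) C v)) a →
      Valuation p (2 * w) b →
      Valuation p (2 * n ∸ 2 * w) c →
      ((+ b / 1) +ℚ divPred (+ 2 -ℤ + (2 * n ∸ 2 * w)) p ≤ℚ (+ a / 1))
      × ((+ c / 1) +ℚ divPred (+ 2 -ℤ + (2 * w)) p ≤ℚ (+ a / 1)))
    × (∀ (a b c : ℕ) →
      Valuation 2 (((n ∸ 1) C u) * ((n ∸ 1) C v)) a →
      Valuation 2 (2 * w) b →
      Valuation 2 (2 * n ∸ 2 * w) c →
      ((+ b / 1) -ℚ (+ (n ∸ w) / 1) ≤ℚ (+ a / 1))
      × ((+ c / 1) -ℚ (+ w / 1) ≤ℚ (+ a / 1)))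
lemma3p4 (suc N) u v w _ u≤N v≤N u+v+1≡2w 1≤w w≤N rewrite sym (*-distribˡ-∸ 2 (suc N) w) =
  (λ p p-prime p≢2 a b c νa νb νc →
     odd-prime-estimate {a = a} {b} p-prime p≢2 1≤M (bound-w p-prime) νa νb ,
     odd-prime-estimate {a = a} {c} p-prime p≢2 1≤w (bound-M p-prime) νa νc) ,
  (λ a b c νa νb νc → two-estimate {W = w} {M} {a} {b} (bound-w prime[2]) νa νb ,
                      two-estimate {W = M} {w} {a} {c} (bound-M prime[2]) νa νc)
  where
  M = suc N ∸ w
  w+M≡1+N : w + M ≡ suc N
  w+M≡1+N = m+[n∸m]≡n (m≤n⇒m≤1+n w≤N)
  1≤M : 1 ≤ M
  1≤M = m<n⇒0<n∸m (s≤s w≤N)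
  bound-w : ∀ {p} → Prime p → ValuationBound p ((N C u) * (N C v)) w M
  bound-w p-prime = binomial-product-bound p-prime {w = w} u+v+1≡2w u≤N v≤N w≤N w+M≡1+N
  bound-M : ∀ {p} → Prime p → ValuationBound p ((N C u) * (N C v)) M w
  bound-M {p} p-prime = subst (λ A → ValuationBound p A M w)
    (sym (cong₂ _*_ (nCk≡nC[n∸k] u≤N) (nCk≡nC[n∸k] v≤N)))
    (binomial-product-bound p-prime ([N∸u]+[N∸v]+1≡2M {w = w} u+v+1≡2w u≤N v≤N w+M≡1+N)
      (m∸n≤m N u) (m∸n≤m N v) (∸-monoʳ-≤ (suc N) 1≤w) (trans (+-comm M w) w+M≡1+N))
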